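{- Let $(A,\precsim_A)$ and $(B,\precsim_B)$ be two disjoint totally ordered sets and let $\mathcal{P}_1,\mathcal{P}_2$ be two communications from $A$ to $B$. Consider the distributed systems $((A,\precsim_A)\cup(B,\precsim_B),\mathcal{P}_1)$ and $((A,\precsim_A)\cup(B,\precsim_B),\mathcal{P}_2)$ (each with only the single communication from $A$ to $B$), with causal precedences $\rightarrow_1$ and $\rightarrow_2$ respectively. If $\rightarrow_1=\rightarrow_2$, then either $\mathcal{P}_1=\mathcal{P}_2$ or the causal ordering of messages is not satisfied.
   Context: A communication from $A$ to $B$ is a finite relation $\mathcal{P}\subseteq A\times B$ such that whenever $(a,b)\in\mathcal{P}$: $(a',b)\in\mathcal{P}$ implies $a'=a$, and $(a,b')\in\mathcal{P}$ implies $b'=b$. A distributed system is a family of pairwise disjoint totally ordered sets (processes) $(X_i,\precsim_i)$ together with communications $\mathcal{P}_{ij}$ from $X_i$ to $X_j$ ($i\neq j$, possibly empty). Its causal precedence $\rightarrow$ is the transitive closure of the union of the strict orders $\prec_i$ and all the $\mathcal{P}_{ij}$. The causal ordering of messages is the property: if $a,a'\in X_i$, $b,b'\in X_j$ with $a\mathcal{P}_{ij}b$, $a'\mathcal{P}_{ij}b'$ and $a\prec_i a'$, then $b\prec_j b'$ (a message sent earlier is received earlier). -}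

module Defs where

open import Data.Product using (Σ; _×_; _,_)
open import Data.Sum using (_⊎_; inj₁; inj₂)
open import Data.List using (List)
open import Data.List.Membership.Propositional using (_∈_)
open import Relation.Binary.PropositionalEquality using (_≡_)
open import Relation.Binary.Structures using (IsTotalOrder)
open import Relation.Binary.Construct.Closure.Transitive using (TransClosure)
open import Relation.Nullary using (¬_)

HRel : Set → Set → Set₁
HRel A B = A → B → Set

FiniteRel : {A B : Set} → HRel A B → Set
FiniteRel {A} {B} P = Σ (List (A × B)) λ L → ∀ a b → P a b → (a , b) ∈ L

-- A communication from A to B: a finite relation which is a partial
-- injective function (each event sends/receives at most one message).
record IsCommunication {A B : Set} (P : HRel A B) : Set where
  field
    finite : FiniteRel P
    recvUnique : ∀ {a a' b} → P a b → P a' b → a' ≡ a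
    sendUnique : ∀ {a b b'} → P a b → P a b' → b' ≡ b

Strict : {X : Set} → (X → X → Set) → X → X → Set
Strict _≤_ x y = (x ≤ y) × ¬ (x ≡ y)

-- One step of causal precedence in the distributed system
-- (A , ≾A) ∪ (B , ≾B) with the single communication P from A to B,
-- on the disjoint union A ⊎ B.
data Step {A B : Set} (_≤A_ : A → A → Set) (_≤B_ : B → B → Set)
          (P : HRel A B) : A ⊎ B → A ⊎ B → Set where
  inA  : ∀ {a a'} → Strict _≤A_ a a' → Step _≤A_ _≤B_ P (inj₁ a) (inj₁ a')
  inB  : ∀ {b b'} → Strict _≤B_ b b' → Step _≤A_ _≤B_ P (inj₂ b) (inj₂ b')
  msg  : ∀ {a b} → P a b → Step _≤A_ _≤B_ P (inj₁ a) (inj₂ b)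

Causal : {A B : Set} (_≤A_ : A → A → Set) (_≤B_ : B → B → Set)
         (P : HRel A B) → A ⊎ B → A ⊎ B → Set
Causal _≤A_ _≤B_ P = TransClosure (Step _≤A_ _≤B_ P)

CausalOrdering : {A B : Set} (_≤A_ : A → A → Set) (_≤B_ : B → B → Set)
                 (P : HRel A B) → Set
CausalOrdering _≤A_ _≤B_ P =
  ∀ {a a' b b'} → P a b → P a' b' → Strict _≤A_ a a' → Strict _≤B_ b b'

_≐_ : {X Y : Set} → (X → Y → Set) → (X → Y → Set) → Set
R ≐ S = ∀ x y → (R x y → S x y) × (S x y → R x y)

-- Under causal ordering, a message a ↦ b of P₁ is, by the equality of the
-- causal precedences, relayed by a message a' ↦ b' of P₂ with a ≼ a' and
-- b' ≼ b, which in turn is relayed by a message a'' ↦ b'' of P₁ with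
-- a ≼ a'' and b'' ≼ b.  If a ≺ a'', causal ordering of P₁ forces b ≺ b'',
-- which is absurd; so a'' = a, hence b'' = b, and the two sandwiches
-- collapse to a' = a and b' = b.
module Submission where

open import Defs
open import Data.Product using (_×_; _,_; ∃₂; proj₁; proj₂)
open import Data.Sum using (inj₁; inj₂)
open import Data.Empty using (⊥-elim)
open import Relation.Binary.Core using (_⇒_)
open import Relation.Binary.PropositionalEquality using (_≡_; refl; subst₂)
open import Relation.Binary.Structures
  using (IsPartialOrder; IsStrictPartialOrder; IsTotalOrder)
open import Relation.Binary.Construct.Closure.Transitive using ([_]; _∷_)
open import Relation.Binary.Construct.Closure.Reflexive using (ReflClosure)
  renaming (refl to equal; [_] to strict)
open import Relation.Nullary using (¬_)
import Relation.Binary.Construct.Closure.Reflexive.Properties as ReflClosure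
import Relation.Binary.Construct.NonStrictToStrict as NonStrictToStrict

module StrictOrder {X : Set} {_≤_ : X → X → Set} (≤-po : IsPartialOrder _≡_ _≤_) where

  _≺_ _≼_ : X → X → Set
  _≺_ = Strict _≤_
  _≼_ = ReflClosure _≺_

  ≺-isStrictPartialOrder : IsStrictPartialOrder _≡_ _≺_
  ≺-isStrictPartialOrder = NonStrictToStrict.<-isStrictPartialOrder _≡_ _≤_ ≤-po

  open IsStrictPartialOrder ≺-isStrictPartialOrder public
    using () renaming (trans to ≺-trans)

  open IsPartialOrder (ReflClosure.isPartialOrder ≺-isStrictPartialOrder) public
    using () renaming (trans to ≼-trans; antisym to ≼-antisym)

  ≼⇒≯ : ∀ {x y} → x ≼ y → ¬ y ≺ x
  ≼⇒≯ equal      = IsStrictPartialOrder.irrefl ≺-isStrictPartialOrder refl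
  ≼⇒≯ (strict s) = IsStrictPartialOrder.asym ≺-isStrictPartialOrder s

module Causality {A B : Set} {_≤A_ : A → A → Set} {_≤B_ : B → B → Set}
    (≤A-po : IsPartialOrder _≡_ _≤A_) (≤B-po : IsPartialOrder _≡_ _≤B_) where

  open StrictOrder ≤A-po using () renaming
    (_≼_ to _≼A_; ≼-trans to ≼A-trans; ≼-antisym to ≼A-antisym)
  open StrictOrder ≤B-po using () renaming
    (_≺_ to _≺B_; _≼_ to _≼B_; ≺-trans to ≺B-trans; ≼-trans to ≼B-trans;
     ≼-antisym to ≼B-antisym; ≼⇒≯ to ≼B⇒≯)

  Relayed : HRel A B → A → B → Set
  Relayed P a b = ∃₂ λ a' b' → a ≼A a' × P a' b' × b' ≼B b

  causal-inj₂⇒≺ : ∀ {P b b'} → Causal _≤A_ _≤B_ P (inj₂ b) (inj₂ b') → b ≺B b'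
  causal-inj₂⇒≺ [ inB s ]     = s
  causal-inj₂⇒≺ (inB s ∷ b⟶) = ≺B-trans s (causal-inj₂⇒≺ b⟶)

  causal⇒relayed : ∀ {P a b} → Causal _≤A_ _≤B_ P (inj₁ a) (inj₂ b) → Relayed P a b
  causal⇒relayed [ msg m ]     = _ , _ , equal , m , equal
  causal⇒relayed (msg m ∷ b⟶) = _ , _ , equal , m , strict (causal-inj₂⇒≺ b⟶)
  causal⇒relayed (inA s ∷ a⟶) with causal⇒relayed a⟶
  ... | a' , b' , a≼a' , m , b'≼b = a' , b' , ≼A-trans (strict s) a≼a' , m , b'≼b

  enclosed-message-≡ : ∀ {P} → (∀ {a b b'} → P a b → P a b' → b' ≡ b) →
    CausalOrdering _≤A_ _≤B_ P →
    ∀ {a b a' b'} → P a b → P a' b' → a ≼A a' → b' ≼B b → a' ≡ a × b' ≡ b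
  enclosed-message-≡ send-unique co m m' equal      b'≼b = refl , send-unique m m'
  enclosed-message-≡ send-unique co m m' (strict s) b'≼b = ⊥-elim (≼B⇒≯ b'≼b (co m m' s))

  causal-⊆⇒⊆ : ∀ {P₁ P₂} → IsCommunication P₁ → CausalOrdering _≤A_ _≤B_ P₁ →
    Causal _≤A_ _≤B_ P₁ ⇒ Causal _≤A_ _≤B_ P₂ →
    Causal _≤A_ _≤B_ P₂ ⇒ Causal _≤A_ _≤B_ P₁ →
    P₁ ⇒ P₂
  causal-⊆⇒⊆ {P₂ = P₂} comm co ⟶₁⊆⟶₂ ⟶₂⊆⟶₁ m
    with causal⇒relayed (⟶₁⊆⟶₂ [ msg m ])
  ... | a' , b' , a≼a' , m₂ , b'≼b
    with causal⇒relayed (⟶₂⊆⟶₁ [ msg m₂ ])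
  ... | a'' , b'' , a'≼a'' , m₁ , b''≼b'
    with enclosed-message-≡ (IsCommunication.sendUnique comm) co m m₁
           (≼A-trans a≼a' a'≼a'') (≼B-trans b''≼b' b'≼b)
  ... | refl , refl = subst₂ P₂ (≼A-antisym a'≼a'' a≼a') (≼B-antisym b'≼b b''≼b') m₂

proposition32 : {A B : Set} (_≤A_ : A → A → Set) (_≤B_ : B → B → Set)
    → IsTotalOrder _≡_ _≤A_ → IsTotalOrder _≡_ _≤B_
    → (P₁ P₂ : HRel A B) → IsCommunication P₁ → IsCommunication P₂
    → Causal _≤A_ _≤B_ P₁ ≐ Causal _≤A_ _≤B_ P₂
    → CausalOrdering _≤A_ _≤B_ P₁ × CausalOrdering _≤A_ _≤B_ P₂
    → P₁ ≐ P₂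
proposition32 _≤A_ _≤B_ ≤A-total ≤B-total P₁ P₂ comm₁ comm₂ ⟶₁≐⟶₂ (co₁ , co₂) a b =
  causal-⊆⇒⊆ comm₁ co₁ ⟶₁⊆⟶₂ ⟶₂⊆⟶₁ , causal-⊆⇒⊆ comm₂ co₂ ⟶₂⊆⟶₁ ⟶₁⊆⟶₂
  where
    open Causality (IsTotalOrder.isPartialOrder ≤A-total)
                   (IsTotalOrder.isPartialOrder ≤B-total)
    ⟶₁⊆⟶₂ : Causal _≤A_ _≤B_ P₁ ⇒ Causal _≤A_ _≤B_ P₂
    ⟶₁⊆⟶₂ {x} {y} = proj₁ (⟶₁≐⟶₂ x y)
    ⟶₂⊆⟶₁ : Causal _≤A_ _≤B_ P₂ ⇒ Causal _≤A_ _≤B_ P₁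
    ⟶₂⊆⟶₁ {x} {y} = proj₂ (⟶₁≐⟶₂ x y)
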